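{- Let $T_m$ be a tree of diameter at most $3$ with maximum degree $m$, and let $T_n$ be a tree of diameter at most $3$ with maximum degree $n$. Then $BR(T_m,T_n)=m+n-1$.
   Context: For bipartite graphs $G_1,G_2$, $BR(G_1,G_2)$ is the least integer $N$ such that every red/blue edge-coloring of the complete bipartite graph $K_{N,N}$ contains a red copy of $G_1$ or a blue copy of $G_2$. -}

module Defs where

open import Data.Nat using (ℕ; zero; suc; _+_; _∸_; _≤_; _<_)
open import Data.Fin using (Fin)
open import Data.Bool using (Bool; true; false; if_then_else_)
open import Data.List using (List; []; _∷_; map; length)
open import Data.Nat.ListAction using (sum)
open import Data.List.Relation.Unary.Unique.Propositional using (Unique)
open import Data.Fin.Base using ()
open import Data.List.Base using ()
open import Data.Product using (Σ; ∃; _×_; _,_)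
open import Data.Sum using (_⊎_; inj₁; inj₂)
open import Data.Empty using (⊥)
open import Data.Unit using (⊤)
open import Relation.Nullary using (¬_)
open import Relation.Binary.PropositionalEquality using (_≡_)
open import Function.Definitions using (Injective)
import Data.List as L
import Data.Fin as F

record Graph : Set where
  field
    order : ℕ
    adj   : Fin order → Fin order → Bool
    sym   : ∀ u v → adj u v ≡ adj v u
    irrefl : ∀ v → adj v v ≡ false
open Graph public

Edge : (G : Graph) → Fin (order G) → Fin (order G) → Set
Edge G u v = adj G u v ≡ true

degree : (G : Graph) → Fin (order G) → ℕ
degree G v = sum (map (λ u → if adj G v u then 1 else 0) (L.allFin (order G)))

MaxDegree : Graph → ℕ → Set
MaxDegree G m = (∀ v → degree G v ≤ m) × (∃ λ v → degree G v ≡ m)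

data Walk (G : Graph) : Fin (order G) → Fin (order G) → ℕ → Set where
  nil  : ∀ v → Walk G v v 0
  cons : ∀ {u v w n} → Edge G u v → Walk G v w n → Walk G u w (suc n)

-- vertex list of a walk, without its final vertex
initVertices : ∀ {G u w n} → Walk G u w n → List (Fin (order G))
initVertices (nil v) = []
initVertices {u = u} (cons e p) = u ∷ initVertices p

Connected : Graph → Set
Connected G = ∀ u v → ∃ λ n → Walk G u v n

HasCycle : Graph → Set
HasCycle G = Σ (Fin (order G)) λ v → Σ ℕ λ n → Σ (Walk G v v n) λ p →
             (3 ≤ n) × Unique (initVertices p)

IsTree : Graph → Set
IsTree G = (1 ≤ order G) × Connected G × ¬ HasCycle G

DiameterAtMost : Graph → ℕ → Set
DiameterAtMost G d = ∀ u v → ∃ λ n → (n ≤ d) × Walk G u v n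

data Colour : Set where
  red blue : Colour

-- c i j = colour of the edge between left vertex i and right vertex j
Colouring : ℕ → Set
Colouring N = Fin N → Fin N → Colour

-- vertices of K_{N,N}: inj₁ = left side, inj₂ = right side
KVertex : ℕ → Set
KVertex N = Fin N ⊎ Fin N

ColouredEdge : ∀ {N} → Colouring N → Colour → KVertex N → KVertex N → Set
ColouredEdge c col (inj₁ i) (inj₂ j) = c i j ≡ col
ColouredEdge c col (inj₂ j) (inj₁ i) = c i j ≡ col
ColouredEdge c col (inj₁ _) (inj₁ _) = ⊥
ColouredEdge c col (inj₂ _) (inj₂ _) = ⊥

HasCopy : ∀ {N} → Colouring N → Colour → Graph → Set
HasCopy {N} c col G = Σ (Fin (order G) → KVertex N) λ f →
  Injective _≡_ _≡_ f × (∀ u v → Edge G u v → ColouredEdge c col (f u) (f v))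

Arrows : ℕ → Graph → Graph → Set
Arrows N G₁ G₂ = (c : Colouring N) → HasCopy c red G₁ ⊎ HasCopy c blue G₂

IsBR : Graph → Graph → ℕ → Set
IsBR G₁ G₂ N = Arrows N G₁ G₂ × (∀ N' → N' < N → ¬ Arrows N' G₁ G₂)

module Submission where

-- A tree of diameter ≤ 3 is a double star: it has an edge uv such that
-- every other vertex is adjacent to u or v.  This rests on the uniqueness of paths in
-- an acyclic graph (non-backtracking chains with the same ends have the same length).
--
-- A double star of maximum degree d embeds in colour col on any col-edge
-- ij whose endpoints both have col-degree ≥ d (u ↦ i, v ↦ j, leaves to neighbours).
-- For N = m + n - 1 every colouring of K_{N,N} has a red edge with both red degrees
-- ≥ m or a blue edge with both blue degrees ≥ n; this is a counting argument ending
-- in a double count of red edges.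
--
-- A col-copy of a graph with a vertex of degree k forces a vertex of
-- K_{N,N} with col-degree ≥ k.  For N ≤ m + n - 2 the circulant colouring (ij red
-- when (i + j) mod N < m - 1) has all red degrees < m and all blue degrees < n.

open import Defs renaming (sym to adj-sym; irrefl to adj-irrefl)
open import Data.Nat using (ℕ; suc; _+_; _∸_; _*_; _≤_; _<_; z≤n; s≤s; _≤?_; _<?_)
open import Data.Nat.Properties hiding (_≟_)
open import Data.Nat.ListAction using (sum)
open import Data.Bool using (Bool; true; false; if_then_else_; _∧_; not)
open import Data.Bool.Properties using (T-≡; T?) renaming (_≟_ to _≟ᵇ_)
open import Data.List using (List; []; _∷_; map; length; _++_; allFin; upTo; filterᵇ; _ʳ++_)
open import Data.List.Properties using (ʳ++-defn; length-tabulate; length-map; length-upTo)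
open import Data.List.Relation.Unary.All as All using (All; []; _∷_)
open import Data.List.Relation.Unary.All.Properties using (¬Any⇒All¬; All¬⇒¬Any)
open import Data.List.Relation.Unary.Any using (here; there)
open import Data.List.Relation.Unary.Unique.Propositional using (Unique)
open import Data.List.Relation.Unary.Unique.Propositional.Properties using (filter⁺; allFin⁺)
open import Data.List.Relation.Unary.AllPairs using ([]; _∷_)
open import Data.List.Membership.Propositional using (_∈_; _∉_)
open import Data.List.Membership.Propositional.Properties using (∈-filter⁺; ∈-filter⁻; ∈-++⁺ʳ; ∈-allFin; ∈-map⁻; ∈-upTo⁺)
open import Data.Fin using (Fin; fromℕ<; toℕ) renaming (_≟_ to _≟ᶠ_)
open import Data.Fin.Properties using (any?; toℕ<n; toℕ-injective)
open import Data.Product as Product using (Σ; ∃; _×_; _,_; proj₁; proj₂; uncurry)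
open import Data.Sum using (_⊎_; inj₁; inj₂; swap; reduce; [_,_]′)
open import Data.Sum.Properties using (inj₁-injective; inj₂-injective; swap-involutive)
open import Data.Empty using (⊥; ⊥-elim)
open import Data.Unit using (⊤; tt)
open import Function using (_∘_; id; Equivalence)
open import Relation.Nullary using (¬_; yes; no; Dec; does; ¬?; _×-dec_)
open import Relation.Binary.Definitions using (DecidableEquality)
open import Relation.Binary.PropositionalEquality using (_≡_; _≢_; refl; sym; trans; cong; subst; subst₂)
open import Algebra.Properties.CommutativeSemigroup +-commutativeSemigroup using (interchange)

count : {A : Set} → (A → Bool) → List A → ℕ
count p xs = sum (map (λ x → if p x then 1 else 0) xs)

InjectiveOn : {A B : Set} → (A → B) → List A → Set
InjectiveOn f xs = ∀ {x y} → x ∈ xs → y ∈ xs → f x ≡ f y → x ≡ y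

module _ {A : Set} where

  ∈-filterᵇ⁺ : ∀ (p : A → Bool) {x xs} → x ∈ xs → p x ≡ true → x ∈ filterᵇ p xs
  ∈-filterᵇ⁺ p x∈xs px = ∈-filter⁺ (T? ∘ p) x∈xs (Equivalence.from T-≡ px)

  ∈-filterᵇ⁻ : ∀ (p : A → Bool) {x} xs → x ∈ filterᵇ p xs → x ∈ xs × p x ≡ true
  ∈-filterᵇ⁻ p _ x∈ = Product.map₂ (Equivalence.to T-≡) (∈-filter⁻ (T? ∘ p) x∈)

  length-filterᵇ : ∀ p (xs : List A) → length (filterᵇ p xs) ≡ count p xs
  length-filterᵇ p [] = refl
  length-filterᵇ p (x ∷ xs) with p x
  ... | true  = cong suc (length-filterᵇ p xs)
  ... | false = length-filterᵇ p xs

  count-witness : ∀ p (xs : List A) → 1 ≤ count p xs → ∃ λ x → x ∈ xs × p x ≡ true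
  count-witness p (x ∷ xs) h with p x in px
  ... | true  = x , here refl , px
  ... | false = let (y , y∈xs , py) = count-witness p xs h in y , there y∈xs , py

  count-positive : ∀ p {x} (xs : List A) → x ∈ xs → p x ≡ true → 1 ≤ count p xs
  count-positive p (y ∷ xs) (here refl) px rewrite px = s≤s z≤n
  count-positive p (y ∷ xs) (there x∈) px with p y
  ... | true  = s≤s z≤n
  ... | false = count-positive p xs x∈ px

  count-mono : ∀ p q (xs : List A) → (∀ {x} → x ∈ xs → p x ≡ true → q x ≡ true) →
               count p xs ≤ count q xs
  count-mono p q [] h = z≤n
  count-mono p q (x ∷ xs) h with p x in px | q x in qx
  ... | true  | true  = s≤s (count-mono p q xs (h ∘ there))
  ... | false | true  = m≤n⇒m≤1+n (count-mono p q xs (h ∘ there))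
  ... | false | false = count-mono p q xs (h ∘ there)
  ... | true  | false with () ← trans (sym (h (here refl) px)) qx

  count-complement : ∀ p q (xs : List A) → (∀ x → q x ≡ not (p x)) →
                     count p xs + count q xs ≡ length xs
  count-complement p q [] _ = refl
  count-complement p q (x ∷ xs) q≡¬p rewrite q≡¬p x with p x
  ... | true  = cong suc (count-complement p q xs q≡¬p)
  ... | false = trans (+-suc (count p xs) _) (cong suc (count-complement p q xs q≡¬p))

  remove : ∀ {x : A} {xs} → x ∈ xs → List A
  remove {xs = _ ∷ xs} (here _)   = xs
  remove {xs = y ∷ _}  (there x∈) = y ∷ remove x∈

  length-remove : ∀ {x : A} {xs} (x∈xs : x ∈ xs) → suc (length (remove x∈xs)) ≡ length xs
  length-remove (here _)   = refl
  length-remove (there x∈) = cong suc (length-remove x∈)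

  ∈-remove : ∀ {x y : A} {xs} (x∈xs : x ∈ xs) → y ∈ xs → y ≢ x → y ∈ remove x∈xs
  ∈-remove (here refl) (here refl) y≢x = ⊥-elim (y≢x refl)
  ∈-remove (here _)    (there y∈)  _   = y∈
  ∈-remove (there _)   (here refl) _   = here refl
  ∈-remove (there x∈)  (there y∈)  y≢x = there (∈-remove x∈ y∈ y≢x)

  pigeonhole : ∀ {xs ys : List A} → Unique xs → (∀ {x} → x ∈ xs → x ∈ ys) → length xs ≤ length ys
  pigeonhole {[]}     _            _   = z≤n
  pigeonhole {x ∷ xs} {ys} (x∉xs ∷ uxs) sub =
    subst (suc (length xs) ≤_) (length-remove x∈ys) (s≤s (pigeonhole uxs sub′))
    where
      x∈ys : x ∈ ys
      x∈ys = sub (here refl)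
      sub′ : ∀ {y} → y ∈ xs → y ∈ remove x∈ys
      sub′ y∈xs = ∈-remove x∈ys (sub (there y∈xs)) (λ y≡x → All.lookup x∉xs y∈xs (sym y≡x))

  map-unique : ∀ {B : Set} (f : A → B) {xs} → Unique xs → InjectiveOn f xs → Unique (map f xs)
  map-unique f {[]}     []         inj = []
  map-unique f {x ∷ xs} (x∉ ∷ uxs) inj =
    ¬Any⇒All¬ (map f xs) fx∉ ∷ map-unique f uxs (λ p q → inj (there p) (there q))
    where
      fx∉ : f x ∉ map f xs
      fx∉ fx∈ with ∈-map⁻ f fx∈
      ... | y , y∈xs , fx≡fy = All.lookup x∉ y∈xs (inj (here refl) (there y∈xs) fx≡fy)

  unique-filterᵇ : ∀ p (xs : List A) → Unique xs → Unique (filterᵇ p xs)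
  unique-filterᵇ p _ = filter⁺ (T? ∘ p)

module _ {A : Set} (_≟_ : DecidableEquality A) where

  except : (A → Bool) → A → A → Bool
  except p k x = p x ∧ not (does (x ≟ k))

  except⁻ : ∀ p k {x} → except p k x ≡ true → p x ≡ true × x ≢ k
  except⁻ p k {x} h with p x | x ≟ k
  except⁻ p k {x} () | false | _
  except⁻ p k {x} () | true  | yes _
  except⁻ p k {x} h  | true  | no x≢k = refl , x≢k

  except⁺ : ∀ p k {x} → p x ≡ true → x ≢ k → except p k x ≡ true
  except⁺ p k {x} px x≢k with x ≟ k
  ... | yes x≡k = ⊥-elim (x≢k x≡k)
  ... | no _ rewrite px = refl

  count-except : ∀ p {k} {xs} → Unique xs → k ∈ xs → p k ≡ true →
                 suc (count (except p k) xs) ≡ count p xs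
  count-except p {k} {xs} uxs k∈xs pk =
    subst₂ (λ a b → suc a ≡ b) (length-filterᵇ (except p k) xs) (length-filterᵇ p xs)
      (≤-antisym (pigeonhole (¬Any⇒All¬ rest k∉rest ∷ unique-filterᵇ (except p k) xs uxs) rest⊆all)
                 (pigeonhole (unique-filterᵇ p xs uxs) all⊆rest))
    where
      rest : List A
      rest = filterᵇ (except p k) xs
      k∉rest : k ∉ rest
      k∉rest k∈ = proj₂ (except⁻ p k (proj₂ (∈-filterᵇ⁻ (except p k) xs k∈))) refl
      rest⊆all : ∀ {x} → x ∈ k ∷ rest → x ∈ filterᵇ p xs
      rest⊆all (here refl) = ∈-filterᵇ⁺ p k∈xs pk
      rest⊆all (there x∈) = let (x∈xs , ex) = ∈-filterᵇ⁻ (except p k) xs x∈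
                            in ∈-filterᵇ⁺ p x∈xs (proj₁ (except⁻ p k ex))
      all⊆rest : ∀ {x} → x ∈ filterᵇ p xs → x ∈ k ∷ rest
      all⊆rest {x} x∈ with x ≟ k
      ... | yes refl = here refl
      ... | no x≢k = let (x∈xs , px) = ∈-filterᵇ⁻ p xs x∈
                     in there (∈-filterᵇ⁺ (except p k) x∈xs (except⁺ p k px x≢k))

  -- a list injects into any duplicate-free list that is at least as long
  -- (the default value d is used off the list)
  injectInto : ∀ {B : Set} (xs : List A) (ys : List B) → Unique ys → length xs ≤ length ys → B →
               Σ (A → B) λ g → (∀ {x} → x ∈ xs → g x ∈ ys) × InjectiveOn g xs
  injectInto []       ys       _            _         d = (λ _ → d) , (λ ()) , (λ ())
  injectInto (x ∷ xs) (y ∷ ys) (y∉ys ∷ uys) (s≤s len) d = g , into , inj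
    where
      rec : Σ (A → _) λ g → (∀ {x} → x ∈ xs → g x ∈ ys) × InjectiveOn g xs
      rec = injectInto xs ys uys len d
      g : A → _
      g z with z ≟ x
      ... | yes _ = y
      ... | no _  = proj₁ rec z
      tail∈ : ∀ {z} → z ∈ x ∷ xs → z ≢ x → z ∈ xs
      tail∈ (here z≡x) z≢x = ⊥-elim (z≢x z≡x)
      tail∈ (there z∈) _   = z∈
      into : ∀ {z} → z ∈ x ∷ xs → g z ∈ y ∷ ys
      into {z} z∈ with z ≟ x
      ... | yes _   = here refl
      ... | no z≢x = there (proj₁ (proj₂ rec) (tail∈ z∈ z≢x))
      y∉rec : ∀ {z} → z ∈ x ∷ xs → z ≢ x → y ≢ proj₁ rec z
      y∉rec z∈ z≢x y≡ = All.lookup y∉ys (proj₁ (proj₂ rec) (tail∈ z∈ z≢x)) y≡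
      inj : InjectiveOn g (x ∷ xs)
      inj {z} {z′} z∈ z′∈ gz≡gz′ with z ≟ x | z′ ≟ x
      ... | yes z≡x | yes z′≡x = trans z≡x (sym z′≡x)
      ... | yes _   | no z′≢x  = ⊥-elim (y∉rec z′∈ z′≢x gz≡gz′)
      ... | no z≢x  | yes _    = ⊥-elim (y∉rec z∈ z≢x (sym gz≡gz′))
      ... | no z≢x  | no z′≢x  = proj₂ (proj₂ rec) (tail∈ z∈ z≢x) (tail∈ z′∈ z′≢x) gz≡gz′

count-bound : ∀ {A : Set} {k} p (xs : List A) → Unique xs → (key : A → ℕ) →
              InjectiveOn key (filterᵇ p xs) → (∀ {x} → x ∈ xs → p x ≡ true → key x < k) →
              count p xs ≤ k
count-bound {k = k} p xs uxs key inj below = begin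
  count p xs                        ≡⟨ length-filterᵇ p xs ⟨
  length (filterᵇ p xs)             ≡⟨ length-map key (filterᵇ p xs) ⟨
  length (map key (filterᵇ p xs))   ≤⟨ pigeonhole (map-unique key (unique-filterᵇ p xs uxs) inj) below′ ⟩
  length (upTo k)                   ≡⟨ length-upTo k ⟩
  k                                 ∎
  where
    open ≤-Reasoning
    below′ : ∀ {y} → y ∈ map key (filterᵇ p xs) → y ∈ upTo k
    below′ y∈ with x , x∈ , refl ← ∈-map⁻ key y∈ = ∈-upTo⁺ (uncurry below (∈-filterᵇ⁻ p xs x∈))

module _ {A : Set} where

  sum-map-+ : ∀ (f g : A → ℕ) xs → sum (map (λ x → f x + g x) xs) ≡ sum (map f xs) + sum (map g xs)
  sum-map-+ f g []       = refl
  sum-map-+ f g (x ∷ xs) = trans (cong (f x + g x +_) (sum-map-+ f g xs))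
                                 (interchange (f x) (g x) (sum (map f xs)) (sum (map g xs)))

  sum-map-0 : ∀ (xs : List A) → sum (map (λ _ → 0) xs) ≡ 0
  sum-map-0 []       = refl
  sum-map-0 (_ ∷ xs) = sum-map-0 xs

  sum-lower : ∀ (f : A → ℕ) k xs → (∀ x → k ≤ f x) → length xs * k ≤ sum (map f xs)
  sum-lower f k []       h = z≤n
  sum-lower f k (x ∷ xs) h = +-mono-≤ (h x) (sum-lower f k xs h)

  sum-upper : ∀ (f : A → ℕ) k xs → (∀ x → f x < k) → length xs + sum (map f xs) ≤ length xs * k
  sum-upper f k []       h = z≤n
  sum-upper f k (x ∷ xs) h = subst (_≤ k + length xs * k) (sym (interchange 1 (length xs) (f x) _))
                                   (+-mono-≤ (h x) (sum-upper f k xs h))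

double-count : ∀ {A B : Set} (P : A → B → Bool) (xs : List A) (ys : List B) →
  sum (map (λ x → count (P x) ys) xs) ≡ sum (map (λ y → count (λ x → P x y) xs) ys)
double-count P []       ys = sym (sum-map-0 ys)
double-count P (x ∷ xs) ys = trans (cong (count (P x) ys +_) (double-count P xs ys))
  (sym (sum-map-+ (λ y → if P x y then 1 else 0) (λ y → count (λ x′ → P x′ y) xs) ys))

Vertex : Graph → Set
Vertex G = Fin (order G)

edge-sym : ∀ G {x y : Vertex G} → Edge G x y → Edge G y x
edge-sym G {x} {y} e = trans (adj-sym G y x) e

edge-irrefl : ∀ G {x : Vertex G} → ¬ Edge G x x
edge-irrefl G {x} e with () ← trans (sym e) (adj-irrefl G x)

Chain : (G : Graph) → List (Vertex G) → Set
Chain G []           = ⊤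
Chain G (x ∷ [])     = ⊤
Chain G (x ∷ y ∷ xs) = Edge G x y × Chain G (y ∷ xs)

NonBacktracking : {V : Set} → List V → Set
NonBacktracking []               = ⊤
NonBacktracking (x ∷ [])         = ⊤
NonBacktracking (x ∷ y ∷ [])     = ⊤
NonBacktracking (x ∷ y ∷ z ∷ xs) = x ≢ z × NonBacktracking (y ∷ z ∷ xs)

endpoint : {V : Set} → V → List V → V
endpoint a []       = a
endpoint a (x ∷ xs) = endpoint x xs

NBChain : (G : Graph) → Vertex G → Vertex G → List (Vertex G) → Set
NBChain G a b xs = Chain G (a ∷ xs) × NonBacktracking (a ∷ xs) × endpoint a xs ≡ b

Chain-tail : ∀ {G} x xs → Chain G (x ∷ xs) → Chain G xs
Chain-tail x []      _       = tt
Chain-tail x (_ ∷ _) (_ , c) = c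

NonBacktracking-tail : ∀ {V : Set} (x : V) xs → NonBacktracking (x ∷ xs) → NonBacktracking xs
NonBacktracking-tail x []          _       = tt
NonBacktracking-tail x (_ ∷ [])    _       = tt
NonBacktracking-tail x (_ ∷ _ ∷ _) (_ , n) = n

endpoint-∈ : ∀ {V : Set} (a : V) xs → endpoint a xs ∈ a ∷ xs
endpoint-∈ a []       = here refl
endpoint-∈ a (x ∷ xs) = there (endpoint-∈ x xs)

shortcut : ∀ {G a b k} → Walk G a b k → ∃ λ xs → NBChain G a b xs × length xs ≤ k
shortcut (nil v) = [] , (tt , tt , refl) , z≤n
shortcut {G} {a} (cons {v = v} e w) with shortcut w
... | []     , (_ , _ , v≡b) , _ = v ∷ [] , ((e , tt) , tt , v≡b) , s≤s z≤n
... | z ∷ xs , (c , n , end) , len with z ≟ᶠ a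
...   | yes refl = xs , (Chain-tail v (z ∷ xs) c , NonBacktracking-tail v (z ∷ xs) n , end) ,
                   m≤n⇒m≤1+n (≤-trans (n≤1+n _) len)
...   | no z≢a   = v ∷ z ∷ xs , ((e , c) , ((λ a≡z → z≢a (sym a≡z)) , n) , end) , s≤s len

module Forest (G : Graph) (acyclic : ¬ HasCycle G) where

  V : Set
  V = Vertex G

  before : ∀ {b : V} {xs} → b ∈ xs → List V
  before (here _)                = []
  before {xs = y ∷ _} (there b∈) = y ∷ before b∈

  before-⊆ : ∀ {b x : V} {xs} (b∈xs : b ∈ xs) → x ∈ before b∈xs → x ∈ xs
  before-⊆ (there _)  (here refl) = here refl
  before-⊆ (there b∈) (there x∈)  = there (before-⊆ b∈ x∈)

  before-unique : ∀ {b : V} {xs} (b∈xs : b ∈ xs) → Unique xs →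
                  Unique (before b∈xs) × b ∉ before b∈xs
  before-unique (here _)   _           = [] , λ ()
  before-unique (there b∈) (y∉ ∷ uxs) =
    let (u , b∉) = before-unique b∈ uxs
    in (¬Any⇒All¬ _ (λ y∈ → All¬⇒¬Any y∉ (before-⊆ b∈ y∈)) ∷ u) ,
       λ { (here refl) → All¬⇒¬Any y∉ b∈ ; (there b∈′) → b∉ b∈′ }

  walkTo : ∀ {b} a xs → Chain G (a ∷ xs) → (b∈xs : b ∈ xs) →
           Σ (Walk G a b (suc (length (before b∈xs)))) λ w → initVertices w ≡ a ∷ before b∈xs
  walkTo a (y ∷ xs) (e , c) (here refl) = cons e (nil y) , refl
  walkTo a (y ∷ xs) (e , c) (there b∈)  =
    let (w , eq) = walkTo y xs c b∈ in cons e w , cong (a ∷_) eq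

  -- a non-backtracking chain a ∷ x ∷ rest whose tail is a path cannot return to a:
  -- a return after at least three steps would close a cycle
  no-return : ∀ a x rest → Chain G (a ∷ x ∷ rest) → NonBacktracking (a ∷ x ∷ rest) →
              Unique (x ∷ rest) → a ∉ x ∷ rest
  no-return a x rest (e , _) _ _ (here refl) = edge-irrefl G e
  no-return a x (_ ∷ _) _ (a≢z , _) _ (there (here a≡z)) = a≢z a≡z
  no-return a x rest c _ u a∈@(there (there _)) =
    let (w , eq)     = walkTo a (x ∷ rest) c a∈
        (ub , a∉b)  = before-unique a∈ u
    in acyclic (a , _ , w , s≤s (s≤s (s≤s z≤n)) ,
                subst Unique (sym eq) (¬Any⇒All¬ _ a∉b ∷ ub))

  nonBacktracking-unique : ∀ xs → Chain G xs → NonBacktracking xs → Unique xs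
  nonBacktracking-unique []           _ _ = []
  nonBacktracking-unique (x ∷ [])     _ _ = [] ∷ []
  nonBacktracking-unique (a ∷ x ∷ rest) c n =
    let u = nonBacktracking-unique (x ∷ rest) (proj₂ c) (NonBacktracking-tail a _ n)
    in ¬Any⇒All¬ _ (no-return a x rest c n u) ∷ u

  reverse-chain : ∀ x xs acc → Chain G (x ∷ xs) → Chain G (x ∷ acc) → Chain G (xs ʳ++ x ∷ acc)
  reverse-chain x []       acc _       c₂ = c₂
  reverse-chain x (y ∷ xs) acc (e , c₁) c₂ = reverse-chain y xs (x ∷ acc) c₁ (edge-sym G e , c₂)

  Departs : List V → List V → Set
  Departs (y ∷ _) (z ∷ _) = y ≢ z
  Departs _       _       = ⊤

  reverse-nonBacktracking : ∀ x xs acc → NonBacktracking (x ∷ xs) → NonBacktracking (x ∷ acc) →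
                            Departs xs acc → NonBacktracking (xs ʳ++ x ∷ acc)
  reverse-nonBacktracking x []       acc _  n₂ _ = n₂
  reverse-nonBacktracking x (y ∷ xs) acc n₁ n₂ d =
    reverse-nonBacktracking y xs (x ∷ acc) (NonBacktracking-tail x (y ∷ xs) n₁) (turn acc n₂ d) (depart xs n₁)
    where
      turn : ∀ acc → NonBacktracking (x ∷ acc) → Departs (y ∷ xs) acc → NonBacktracking (y ∷ x ∷ acc)
      turn []      _ _   = tt
      turn (_ ∷ _) n y≢z = y≢z , n
      depart : ∀ xs → NonBacktracking (x ∷ y ∷ xs) → Departs xs (x ∷ acc)
      depart []      _         = tt
      depart (_ ∷ _) (x≢z , _) = λ z≡x → x≢z (sym z≡x)

  reverse-head : ∀ (x : V) xs acc → ∃ λ t → xs ʳ++ x ∷ acc ≡ endpoint x xs ∷ t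
  reverse-head x []       acc = acc , refl
  reverse-head x (y ∷ xs) acc = reverse-head y xs (x ∷ acc)

  length-unique : ∀ {a b} xs ys → NBChain G a b xs → NBChain G a b ys → length xs ≡ length ys
  length-unique []       []       _ _ = refl
  length-unique {a} [] (y ∷ ys) (_ , _ , refl) (c , n , end)
    with y∉ ∷ _ ← nonBacktracking-unique (a ∷ y ∷ ys) c n
    = ⊥-elim (All¬⇒¬Any y∉ (subst (_∈ y ∷ ys) end (endpoint-∈ y ys)))
  length-unique {a} (x ∷ xs) [] (c , n , end) (_ , _ , refl)
    with x∉ ∷ _ ← nonBacktracking-unique (a ∷ x ∷ xs) c n
    = ⊥-elim (All¬⇒¬Any x∉ (subst (_∈ x ∷ xs) end (endpoint-∈ x xs)))
  length-unique {a} (x ∷ xs) (y ∷ ys) (c₁ , n₁ , end₁) (c₂ , n₂ , end₂) with x ≟ᶠ y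
  ... | yes refl = cong suc (length-unique xs ys (proj₂ c₁ , NonBacktracking-tail a _ n₁ , end₁)
                                                  (proj₂ c₂ , NonBacktracking-tail a _ n₂ , end₂))
  ... | no x≢y = ⊥-elim (All¬⇒¬Any b∉rest (∈-++⁺ʳ t (there b∈ys)))
    where
      -- the reverse of a ∷ x ∷ xs glued to a ∷ y ∷ ys is a path starting at b,
      -- yet b also lies on y ∷ ys
      glued-path : Unique ((x ∷ xs) ʳ++ a ∷ y ∷ ys)
      glued-path = nonBacktracking-unique _ (reverse-chain a (x ∷ xs) (y ∷ ys) c₁ c₂)
                                            (reverse-nonBacktracking a (x ∷ xs) (y ∷ ys) n₁ n₂ x≢y)
      t : List V
      t = proj₁ (reverse-head x xs [])
      glued≡ : (x ∷ xs) ʳ++ a ∷ y ∷ ys ≡ endpoint x xs ∷ t ++ a ∷ y ∷ ys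
      glued≡ = trans (ʳ++-defn (x ∷ xs)) (cong (_++ a ∷ y ∷ ys) (proj₂ (reverse-head x xs [])))
      b∉rest : All (endpoint x xs ≢_) (t ++ a ∷ y ∷ ys)
      b∉rest with b∉ ∷ _ ← subst Unique glued≡ glued-path = b∉
      b∈ys : endpoint x xs ∈ y ∷ ys
      b∈ys = subst (_∈ y ∷ ys) (trans end₂ (sym end₁)) (endpoint-∈ y ys)

  -- the edge a y and the path a x y would be two paths of different lengths
  no-triangle : ∀ {a x y} → Edge G a x → Edge G x y → Edge G a y → ⊥
  no-triangle {a} {x} {y} ax xy ay
    with () ← length-unique (y ∷ []) (x ∷ y ∷ []) ((ay , tt) , tt , refl)
                ((ax , xy , tt) , ((λ a≡y → edge-irrefl G (subst (Edge G a) (sym a≡y) ay)) , tt) , refl)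

  -- likewise the edge u v and the path u p q v
  no-square : ∀ {u p q v} → Edge G u p → Edge G p q → Edge G q v → Edge G u v →
              u ≢ q → p ≢ v → ⊥
  no-square up pq qv uv u≢q p≢v
    with () ← length-unique (_ ∷ []) (_ ∷ _ ∷ _ ∷ []) ((uv , tt) , tt , refl)
                ((up , pq , qv , tt) , (u≢q , p≢v , tt) , refl)

  no-long-chain : DiameterAtMost G 3 → ∀ {a b} xs → NBChain G a b xs → 4 ≤ length xs → ⊥
  no-long-chain diam {a} {b} xs nb 4≤ with diam a b
  ... | k , k≤3 , w with shortcut w
  ...   | ys , nb′ , len = <-irrefl refl
    (≤-trans 4≤ (subst (_≤ 3) (sym (length-unique xs ys nb nb′)) (≤-trans len k≤3)))

degree-except : ∀ G {u x : Vertex G} → Edge G u x →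
                degree G u ≡ suc (count (except _≟ᶠ_ (adj G u) x) (allFin (order G)))
degree-except G {u} {x} e = sym (count-except _≟ᶠ_ (adj G u) (allFin⁺ _) (∈-allFin x) e)

another-neighbour : ∀ G {u x : Vertex G} → Edge G u x → 2 ≤ degree G u → ∃ λ z → Edge G u z × z ≢ x
another-neighbour G {u} {x} e 2≤deg
  with z , _ , ez ← count-witness (except _≟ᶠ_ (adj G u) x) (allFin _)
                      (≤-pred (subst (2 ≤_) (degree-except G e) 2≤deg))
  = z , except⁻ _≟ᶠ_ (adj G u) x ez

two-neighbours : ∀ G {u x y : Vertex G} → Edge G u x → Edge G u y → y ≢ x → 2 ≤ degree G u
two-neighbours G {u} {x} {y} ex ey y≢x =
  subst (2 ≤_) (sym (degree-except G ex))
        (s≤s (count-positive (except _≟ᶠ_ (adj G u) x) (allFin _) (∈-allFin y) (except⁺ _≟ᶠ_ (adj G u) x ey y≢x)))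

DoubleStar : Graph → Set
DoubleStar G = Σ (Vertex G) λ u → Σ (Vertex G) λ v → Edge G u v ×
  (∀ w → w ≢ u → w ≢ v → adj G u w ≡ false → Edge G v w)

-- If some neighbour v of u has a
-- neighbour outside the closed neighbourhood of u, then uv is the central edge;
-- otherwise T is a star at u and any edge at u will do.
module DoubleStarAt (T : Graph) (acyclic : ¬ HasCycle T) (diam : DiameterAtMost T 3)
                    (u : Vertex T) (u-max : ∀ w → degree T w ≤ degree T u) (u-edge : 1 ≤ degree T u) where
  open Forest T acyclic

  AtDistance2or3 : V → Set
  AtDistance2or3 w = (∃ λ x → Edge T u x × Edge T x w) ⊎
                     (∃ λ x → ∃ λ y → Edge T u x × Edge T x y × Edge T y w × u ≢ y × x ≢ w)

  at-distance-2or3 : ∀ w → w ≢ u → adj T u w ≡ false → AtDistance2or3 w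
  at-distance-2or3 w w≢u u≁w with diam u w
  ... | k , k≤3 , walk with shortcut walk
  ... | []              , (_ , _ , u≡w) , _ = ⊥-elim (w≢u (sym u≡w))
  ... | _ ∷ []          , ((e , _) , _ , refl) , _ with () ← trans (sym e) u≁w
  ... | x ∷ _ ∷ []      , ((e₁ , e₂ , _) , _ , refl) , _ = inj₁ (x , e₁ , e₂)
  ... | x ∷ y ∷ _ ∷ []  , ((e₁ , e₂ , e₃ , _) , (n₁ , n₂ , _) , refl) , _ = inj₂ (x , y , e₁ , e₂ , e₃ , n₁ , n₂)
  ... | _ ∷ _ ∷ _ ∷ _ ∷ _ , _ , len with s≤s (s≤s (s≤s ())) ← ≤-trans len k≤3

  Spine : Set
  Spine = ∃ λ x → ∃ λ w → Edge T u x × Edge T x w × w ≢ u × adj T u w ≡ false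

  spine? : Dec Spine
  spine? = any? λ x → any? λ w → (adj T u x ≟ᵇ true) ×-dec (adj T x w ≟ᵇ true) ×-dec
                                  ¬? (w ≟ᶠ u) ×-dec (adj T u w ≟ᵇ false)

  star : ¬ Spine → DoubleStar T
  star no-spine = u , x₀ , e₀ , cover
    where
      x₀ : V
      x₀ = proj₁ (count-witness (adj T u) (allFin _) u-edge)
      e₀ : Edge T u x₀
      e₀ = proj₂ (proj₂ (count-witness (adj T u) (allFin _) u-edge))
      cover : ∀ w → w ≢ u → w ≢ x₀ → adj T u w ≡ false → Edge T x₀ w
      cover w w≢u _ u≁w with at-distance-2or3 w w≢u u≁w
      ... | inj₁ (x , e₁ , e₂) = ⊥-elim (no-spine (x , w , e₁ , e₂ , w≢u , u≁w))
      ... | inj₂ (x , y , e₁ , e₂ , _ , u≢y , _) with adj T u y in uy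
      ...   | true  = ⊥-elim (no-triangle e₁ e₂ uy)
      ...   | false = ⊥-elim (no-spine (x , y , e₁ , e₂ , (λ y≡u → u≢y (sym y≡u)) , uy))

  -- with a spine u v w*, every vertex not adjacent to u is adjacent to v,
  -- since otherwise T would contain a non-backtracking chain of 4 steps
  spine : Spine → DoubleStar T
  spine (v , w* , uv , vw* , w*≢u , u≁w*) = u , v , uv , cover
    where
      -- a second branch u x y at u, next to u v w*
      branch : ∀ {x y} → Edge T u x → Edge T x y → u ≢ y → x ≢ v → ⊥
      branch ux xy u≢y x≢v = no-long-chain diam (v ∷ u ∷ _ ∷ _ ∷ [])
        ((edge-sym T vw* , edge-sym T uv , ux , xy , tt) ,
         (w*≢u , (λ v≡x → x≢v (sym v≡x)) , u≢y , tt) , refl) ≤-refl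
      cover : ∀ w → w ≢ u → w ≢ v → adj T u w ≡ false → Edge T v w
      cover w w≢u w≢v u≁w with at-distance-2or3 w w≢u u≁w
      ... | inj₁ (x , ux , xw) with x ≟ᶠ v
      ...   | yes refl = xw
      ...   | no x≢v   = ⊥-elim (branch ux xw (λ u≡w → w≢u (sym u≡w)) x≢v)
      cover w w≢u w≢v u≁w | inj₂ (x , y , ux , xy , yw , u≢y , x≢w) with x ≟ᶠ v
      ...   | no x≢v   = ⊥-elim (branch ux xy u≢y x≢v)
      ...   | yes refl = ⊥-elim (no-long-chain diam (u ∷ x ∷ y ∷ w ∷ [])
                           ((edge-sym T uz , ux , xy , yw , tt) ,
                            (z≢x , u≢y , (λ x≡w → w≢v (sym x≡w)) , tt) , refl) ≤-refl)
        where
          -- x has the two neighbours u and y, so u has degree ≥ 2 and a neighbour z ≠ x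
          2≤deg-u : 2 ≤ degree T u
          2≤deg-u = ≤-trans (two-neighbours T (edge-sym T ux) xy (λ y≡u → u≢y (sym y≡u))) (u-max x)
          z : V
          z = proj₁ (another-neighbour T ux 2≤deg-u)
          uz : Edge T u z
          uz = proj₁ (proj₂ (another-neighbour T ux 2≤deg-u))
          z≢x : z ≢ x
          z≢x = proj₂ (proj₂ (another-neighbour T ux 2≤deg-u))

  double-star : DoubleStar T
  double-star with spine?
  ... | yes s = spine s
  ... | no ¬s = star ¬s

tree-double-star : ∀ T {m} → IsTree T → DiameterAtMost T 3 → MaxDegree T m → 1 ≤ m → DoubleStar T
tree-double-star T (_ , _ , acyclic) diam (max , u , deg-u) 1≤m =
  DoubleStarAt.double-star T acyclic diam u (λ w → subst (degree T w ≤_) (sym deg-u) (max w))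
                           (subst (1 ≤_) (sym deg-u) 1≤m)

_==ᶜ_ : Colour → Colour → Bool
red  ==ᶜ red  = true
blue ==ᶜ blue = true
_    ==ᶜ _    = false

==ᶜ-sound : ∀ a b → a ==ᶜ b ≡ true → a ≡ b
==ᶜ-sound red  red  _ = refl
==ᶜ-sound blue blue _ = refl

==ᶜ-complete : ∀ {a b} → a ≡ b → a ==ᶜ b ≡ true
==ᶜ-complete {red}  refl = refl
==ᶜ-complete {blue} refl = refl

degˡ : ∀ {N} → Colouring N → Colour → Fin N → ℕ
degˡ {N} c col i = count (λ j → c i j ==ᶜ col) (allFin N)

degʳ : ∀ {N} → Colouring N → Colour → Fin N → ℕ
degʳ {N} c col j = count (λ i → c i j ==ᶜ col) (allFin N)

-- The
-- central edge uv goes to ij, the other neighbours of u to col-neighbours of i,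
-- and the remaining vertices (neighbours of v) to col-neighbours of j.

module Embedding (T : Graph) (acyclic : ¬ HasCycle T) (d : ℕ) (max : ∀ w → degree T w ≤ d)
                 (u v : Vertex T) (uv : Edge T u v)
                 (cover : ∀ w → w ≢ u → w ≢ v → adj T u w ≡ false → Edge T v w)
                 {N : ℕ} (c : Colouring N) (col : Colour) (i j : Fin N) (cij : c i j ≡ col)
                 (d≤i : d ≤ degˡ c col i) (d≤j : d ≤ degʳ c col j) where
  open Forest T acyclic

  nbrsᵤ nbrsᵥ : List (Vertex T)
  nbrsᵢ nbrsⱼ : List (Fin N)
  nbrsᵤ = filterᵇ (except _≟ᶠ_ (adj T u) v) (allFin (order T))
  nbrsᵢ = filterᵇ (except _≟ᶠ_ (λ j′ → c i j′ ==ᶜ col) j) (allFin N)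
  nbrsᵥ = filterᵇ (except _≟ᶠ_ (adj T v) u) (allFin (order T))
  nbrsⱼ = filterᵇ (except _≟ᶠ_ (λ i′ → c i′ j ==ᶜ col) i) (allFin N)

  -- on each side one element is set aside from a count bounded by d, resp. at least d
  fits-u : length nbrsᵤ ≤ length nbrsᵢ
  fits-u = subst₂ _≤_ (sym (length-filterᵇ _ (allFin (order T)))) (sym (length-filterᵇ _ (allFin N)))
    (≤-pred (begin
      suc (count (except _≟ᶠ_ (adj T u) v) (allFin (order T)))        ≡⟨ degree-except T uv ⟨
      degree T u                                                       ≤⟨ max u ⟩
      d                                                                ≤⟨ d≤i ⟩
      degˡ c col i                                                     ≡⟨ count-except _≟ᶠ_ _ (allFin⁺ N) (∈-allFin j) (==ᶜ-complete cij) ⟨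
      suc (count (except _≟ᶠ_ (λ j′ → c i j′ ==ᶜ col) j) (allFin N))  ∎))
    where open ≤-Reasoning

  fits-v : length nbrsᵥ ≤ length nbrsⱼ
  fits-v = subst₂ _≤_ (sym (length-filterᵇ _ (allFin (order T)))) (sym (length-filterᵇ _ (allFin N)))
    (≤-pred (begin
      suc (count (except _≟ᶠ_ (adj T v) u) (allFin (order T)))        ≡⟨ degree-except T (edge-sym T uv) ⟨
      degree T v                                                       ≤⟨ max v ⟩
      d                                                                ≤⟨ d≤j ⟩
      degʳ c col j                                                     ≡⟨ count-except _≟ᶠ_ _ (allFin⁺ N) (∈-allFin i) (==ᶜ-complete cij) ⟨
      suc (count (except _≟ᶠ_ (λ i′ → c i′ j ==ᶜ col) i) (allFin N))  ∎))
    where open ≤-Reasoning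

  gᵤ : Σ (Vertex T → Fin N) λ g → (∀ {x} → x ∈ nbrsᵤ → g x ∈ nbrsᵢ) × InjectiveOn g nbrsᵤ
  gᵤ = injectInto _≟ᶠ_ nbrsᵤ nbrsᵢ (unique-filterᵇ _ (allFin N) (allFin⁺ N)) fits-u j

  gᵥ : Σ (Vertex T → Fin N) λ g → (∀ {x} → x ∈ nbrsᵥ → g x ∈ nbrsⱼ) × InjectiveOn g nbrsᵥ
  gᵥ = injectInto _≟ᶠ_ nbrsᵥ nbrsⱼ (unique-filterᵇ _ (allFin N) (allFin⁺ N)) fits-v i

  data Kind (w : Vertex T) : Set where
    is-u   : w ≡ u → Kind w
    is-v   : w ≡ v → Kind w
    leaf-u : w ≢ v → Edge T u w → Kind w
    leaf-v : w ≢ u → w ≢ v → adj T u w ≡ false → Kind w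

  kind : ∀ w → Kind w
  kind w with w ≟ᶠ u
  ... | yes w≡u = is-u w≡u
  ... | no w≢u with w ≟ᶠ v
  ...   | yes w≡v = is-v w≡v
  ...   | no w≢v with adj T u w in uw
  ...     | true  = leaf-u w≢v uw
  ...     | false = leaf-v w≢u w≢v uw

  place : ∀ {w} → Kind w → KVertex N
  place     (is-u _)       = inj₁ i
  place     (is-v _)       = inj₂ j
  place {w} (leaf-u _ _)   = inj₂ (proj₁ gᵤ w)
  place {w} (leaf-v _ _ _) = inj₁ (proj₁ gᵥ w)

  ∈nbrsᵤ : ∀ {w} → w ≢ v → Edge T u w → w ∈ nbrsᵤ
  ∈nbrsᵤ w≢v uw = ∈-filterᵇ⁺ _ (∈-allFin _) (except⁺ _≟ᶠ_ (adj T u) v uw w≢v)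

  ∈nbrsᵥ : ∀ {w} → w ≢ u → w ≢ v → adj T u w ≡ false → w ∈ nbrsᵥ
  ∈nbrsᵥ w≢u w≢v u≁w = ∈-filterᵇ⁺ _ (∈-allFin _) (except⁺ _≟ᶠ_ (adj T v) u (cover _ w≢u w≢v u≁w) w≢u)

  gᵤ-good : ∀ {w} → w ≢ v → Edge T u w → c i (proj₁ gᵤ w) ≡ col × proj₁ gᵤ w ≢ j
  gᵤ-good w≢v uw with x∈ ← proj₁ (proj₂ gᵤ) (∈nbrsᵤ w≢v uw)
    = Product.map₁ (==ᶜ-sound _ _) (except⁻ _≟ᶠ_ (λ j′ → c i j′ ==ᶜ col) j (proj₂ (∈-filterᵇ⁻ _ (allFin N) x∈)))

  gᵥ-good : ∀ {w} → w ≢ u → w ≢ v → adj T u w ≡ false → c (proj₁ gᵥ w) j ≡ col × proj₁ gᵥ w ≢ i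
  gᵥ-good w≢u w≢v u≁w with x∈ ← proj₁ (proj₂ gᵥ) (∈nbrsᵥ w≢u w≢v u≁w)
    = Product.map₁ (==ᶜ-sound _ _) (except⁻ _≟ᶠ_ (λ i′ → c i′ j ==ᶜ col) i (proj₂ (∈-filterᵇ⁻ _ (allFin N) x∈)))

  place-injective : ∀ {w w′} (k : Kind w) (k′ : Kind w′) → place k ≡ place k′ → w ≡ w′
  place-injective (is-u w≡u) (is-u w′≡u) _ = trans w≡u (sym w′≡u)
  place-injective (is-v w≡v) (is-v w′≡v) _ = trans w≡v (sym w′≡v)
  place-injective (leaf-u w≢v uw) (leaf-u w′≢v uw′) eq =
    proj₂ (proj₂ gᵤ) (∈nbrsᵤ w≢v uw) (∈nbrsᵤ w′≢v uw′) (inj₂-injective eq)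
  place-injective (leaf-v w≢u w≢v u≁w) (leaf-v w′≢u w′≢v u≁w′) eq =
    proj₂ (proj₂ gᵥ) (∈nbrsᵥ w≢u w≢v u≁w) (∈nbrsᵥ w′≢u w′≢v u≁w′) (inj₁-injective eq)
  place-injective (is-u _) (leaf-v w≢u w≢v u≁w) eq = ⊥-elim (proj₂ (gᵥ-good w≢u w≢v u≁w) (sym (inj₁-injective eq)))
  place-injective (leaf-v w≢u w≢v u≁w) (is-u _) eq = ⊥-elim (proj₂ (gᵥ-good w≢u w≢v u≁w) (inj₁-injective eq))
  place-injective (is-v _) (leaf-u w≢v uw) eq = ⊥-elim (proj₂ (gᵤ-good w≢v uw) (sym (inj₂-injective eq)))
  place-injective (leaf-u w≢v uw) (is-v _) eq = ⊥-elim (proj₂ (gᵤ-good w≢v uw) (inj₂-injective eq))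
  place-injective (is-u _)         (is-v _)         ()
  place-injective (is-u _)         (leaf-u _ _)     ()
  place-injective (is-v _)         (is-u _)         ()
  place-injective (is-v _)         (leaf-v _ _ _)   ()
  place-injective (leaf-u _ _)     (is-u _)         ()
  place-injective (leaf-u _ _)     (leaf-v _ _ _)   ()
  place-injective (leaf-v _ _ _)   (is-v _)         ()
  place-injective (leaf-v _ _ _)   (leaf-u _ _)     ()

  -- every edge of T joins two kinds that are placed on a col-edge; all other
  -- combinations would give a loop, a triangle or a 4-cycle in T
  place-edge : ∀ {w w′} (k : Kind w) (k′ : Kind w′) → Edge T w w′ → ColouredEdge c col (place k) (place k′)
  place-edge (is-u refl)      (is-v refl)      _ = cij
  place-edge (is-v refl)      (is-u refl)      _ = cij
  place-edge (is-u refl)      (leaf-u w≢v uw)  _ = proj₁ (gᵤ-good w≢v uw)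
  place-edge (leaf-u w≢v uw)  (is-u refl)      _ = proj₁ (gᵤ-good w≢v uw)
  place-edge (is-v refl)      (leaf-v w≢u w≢v u≁w) _ = proj₁ (gᵥ-good w≢u w≢v u≁w)
  place-edge (leaf-v w≢u w≢v u≁w) (is-v refl)      _ = proj₁ (gᵥ-good w≢u w≢v u≁w)
  place-edge (is-u refl)      (is-u refl)      e = ⊥-elim (edge-irrefl T e)
  place-edge (is-v refl)      (is-v refl)      e = ⊥-elim (edge-irrefl T e)
  place-edge (is-u refl)      (leaf-v _ _ u≁w) e with () ← trans (sym e) u≁w
  place-edge (leaf-v _ _ u≁w) (is-u refl)      e with () ← trans (sym (edge-sym T e)) u≁w
  place-edge (is-v refl)      (leaf-u _ uw)    e = ⊥-elim (no-triangle uv e uw)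
  place-edge (leaf-u _ uw)    (is-v refl)      e = ⊥-elim (no-triangle uv (edge-sym T e) uw)
  place-edge (leaf-u _ uw)    (leaf-u _ uw′)   e = ⊥-elim (no-triangle uw e uw′)
  place-edge (leaf-v w≢u w≢v u≁w) (leaf-v w′≢u w′≢v u≁w′) e =
    ⊥-elim (no-triangle (cover _ w≢u w≢v u≁w) e (cover _ w′≢u w′≢v u≁w′))
  place-edge (leaf-u w≢v uw) (leaf-v w′≢u w′≢v u≁w′) e =
    ⊥-elim (no-square uw e (edge-sym T (cover _ w′≢u w′≢v u≁w′)) uv (λ u≡w′ → w′≢u (sym u≡w′)) w≢v)
  place-edge (leaf-v w≢u w≢v u≁w) (leaf-u w′≢v uw′) e =
    ⊥-elim (no-square uw′ (edge-sym T e) (edge-sym T (cover _ w≢u w≢v u≁w)) uv (λ u≡w → w≢u (sym u≡w)) w′≢v)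

  copy : HasCopy c col T
  copy = (λ w → place (kind w)) ,
         (λ {w} {w′} → place-injective (kind w) (kind w′)) ,
         (λ w w′ → place-edge (kind w) (kind w′))

double-star-copy : ∀ T {d} → IsTree T → DiameterAtMost T 3 → MaxDegree T d → 1 ≤ d →
                   ∀ {N} (c : Colouring N) col i j → c i j ≡ col →
                   d ≤ degˡ c col i → d ≤ degʳ c col j → HasCopy c col T
double-star-copy T tree@(_ , _ , acyclic) diam maxdeg@(max , _) 1≤d c col i j cij d≤i d≤j
  with u , v , uv , cover ← tree-double-star T tree diam maxdeg 1≤d
  = Embedding.copy T acyclic _ max u v uv cover c col i j cij d≤i d≤j

-- Otherwise call a vertex rich if its red degree is ≥ m (so a poor
-- vertex has blue degree ≥ n).  A rich vertex has ≥ m poor red neighbours and a poor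
-- vertex ≥ n rich blue neighbours on the other side, so as m + n > N each side is
-- all rich or all poor; the sides differ, and double counting red edges between an
-- all-rich and an all-poor side is impossible.  Transposing the colouring swaps the
-- sides, which halves the case analysis.

_≟ᶜ_ : (a b : Colour) → Dec (a ≡ b)
red  ≟ᶜ red  = yes refl
blue ≟ᶜ blue = yes refl
red  ≟ᶜ blue = no λ ()
blue ≟ᶜ red  = no λ ()

transpose : ∀ {N} → Colouring N → Colouring N
transpose c j i = c i j

length-allFin : ∀ N → length (allFin N) ≡ N
length-allFin N = length-tabulate id

degˡ-red+blue : ∀ {N} (c : Colouring N) i → degˡ c red i + degˡ c blue i ≡ N
degˡ-red+blue {N} c i = trans (count-complement _ _ (allFin N) (λ j → blue-test (c i j)))
                              (length-allFin N)
  where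
    blue-test : ∀ a → a ==ᶜ blue ≡ not (a ==ᶜ red)
    blue-test red  = refl
    blue-test blue = refl

degree-mismatch : ∀ {N} (c : Colouring N) col k → 1 ≤ N →
                  (∀ i → k ≤ degˡ c col i) → (∀ j → degʳ c col j < k) → ⊥
degree-mismatch {N} c col k 1≤N left right = <-irrefl refl (≤-trans 1≤N (+-cancelʳ-≤ Sʳ N 0 (begin
  N + Sʳ  ≤⟨ subst (λ l → l + Sʳ ≤ l * k) (length-allFin N) (sum-upper (degʳ c col) k (allFin N) right) ⟩
  N * k   ≤⟨ subst (λ l → l * k ≤ Sˡ) (length-allFin N) (sum-lower (degˡ c col) k (allFin N) left) ⟩
  Sˡ      ≡⟨ double-count (λ i j → c i j ==ᶜ col) (allFin N) (allFin N) ⟩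
  Sʳ      ∎)))
  where
    open ≤-Reasoning
    Sˡ Sʳ : ℕ
    Sˡ = sum (map (degˡ c col) (allFin N))
    Sʳ = sum (map (degʳ c col) (allFin N))

GoodEdge : ∀ {N} → Colouring N → Colour → ℕ → Set
GoodEdge {N} c col k = ∃ λ i → ∃ λ j → c i j ≡ col × k ≤ degˡ c col i × k ≤ degʳ c col j

good-edge? : ∀ {N} (c : Colouring N) col k → Dec (GoodEdge c col k)
good-edge? c col k = any? λ i → any? λ j → (c i j ≟ᶜ col) ×-dec (k ≤? degˡ c col i) ×-dec (k ≤? degʳ c col j)

module UpperBound (m n : ℕ) (1≤m : 1 ≤ m) (1≤n : 1 ≤ n) {N : ℕ} (N≡ : suc N ≡ m + n) where

  1≤N : 1 ≤ N
  1≤N = ≤-pred (subst (2 ≤_) (sym N≡) (+-mono-≤ 1≤m 1≤n))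

  Rich : Colouring N → Fin N → Set
  Rich c i = m ≤ degˡ c red i

  rich? : Colouring N → Fin N → Bool
  rich? c i with m ≤? degˡ c red i
  ... | yes _ = true
  ... | no _  = false

  Balanced : Colouring N → Set
  Balanced c = ¬ GoodEdge c red m × ¬ GoodEdge c blue n

  balanced-transpose : ∀ {c} → Balanced c → Balanced (transpose c)
  balanced-transpose (no-red , no-blue) =
    (λ (j , i , e , dj , di) → no-red (i , j , e , di , dj)) ,
    (λ (j , i , e , dj , di) → no-blue (i , j , e , di , dj))

  poor⇒blue : ∀ c i → ¬ Rich c i → n ≤ degˡ c blue i
  poor⇒blue c i poor = +-cancelˡ-≤ m n _ (begin
    m + n                             ≡⟨ N≡ ⟨
    suc N                             ≡⟨ cong suc (degˡ-red+blue c i) ⟨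
    suc (degˡ c red i) + degˡ c blue i ≤⟨ +-monoˡ-≤ _ (≰⇒> poor) ⟩
    m + degˡ c blue i                 ∎)
    where open ≤-Reasoning

  rich?-sound : ∀ c i → rich? c i ≡ true → Rich c i
  rich?-sound c i h with m ≤? degˡ c red i
  ... | yes r = r

  poor?-sound : ∀ c i → not (rich? c i) ≡ true → ¬ Rich c i
  poor?-sound c i h r with m ≤? degˡ c red i
  poor?-sound c i () r | yes _
  ... | no ¬r = ¬r r

  -- the red neighbours of a rich vertex are poor
  rich⇒many-poor : ∀ c → Balanced c → ∀ {i} → Rich c i →
                   m ≤ count (not ∘ rich? (transpose c)) (allFin N)
  rich⇒many-poor c (no-red , _) {i} rich-i = ≤-trans rich-i (count-mono _ _ (allFin N) poor)
    where
      poor : ∀ {j} → j ∈ allFin N → c i j ==ᶜ red ≡ true → not (rich? (transpose c) j) ≡ true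
      poor {j} _ red-ij with m ≤? degʳ c red j
      ... | yes rich-j = ⊥-elim (no-red (i , j , ==ᶜ-sound _ _ red-ij , rich-i , rich-j))
      ... | no _       = refl

  -- the blue neighbours of a poor vertex are rich
  poor⇒many-rich : ∀ c → Balanced c → ∀ {i} → ¬ Rich c i →
                   n ≤ count (rich? (transpose c)) (allFin N)
  poor⇒many-rich c (_ , no-blue) {i} poor-i = ≤-trans (poor⇒blue c i poor-i) (count-mono _ _ (allFin N) rich)
    where
      rich : ∀ {j} → j ∈ allFin N → c i j ==ᶜ blue ≡ true → rich? (transpose c) j ≡ true
      rich {j} _ blue-ij with m ≤? degʳ c red j
      ... | yes _      = refl
      ... | no poor-j  = ⊥-elim (no-blue (i , j , ==ᶜ-sound _ _ blue-ij , poor⇒blue c i poor-i ,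
                                          poor⇒blue (transpose c) j poor-j))

  -- a side cannot contain both a rich and a poor vertex, as m + n > N
  homogeneous : ∀ c → Balanced c → ∀ {i i′} → Rich c i → ¬ Rich c i′ → ⊥
  homogeneous c bal rich-i poor-i′ = <-irrefl refl (begin-strict
    N                                                           <⟨ n<1+n N ⟩
    suc N                                                       ≡⟨ N≡ ⟩
    m + n                                                       ≤⟨ +-mono-≤ (rich⇒many-poor c bal rich-i) (poor⇒many-rich c bal poor-i′) ⟩
    count (not ∘ rich? (transpose c)) (allFin N) + count (rich? (transpose c)) (allFin N)
                                                                ≡⟨ +-comm _ (count (rich? (transpose c)) (allFin N)) ⟩
    count (rich? (transpose c)) (allFin N) + count (not ∘ rich? (transpose c)) (allFin N)
                                                                ≡⟨ count-complement _ _ (allFin N) (λ _ → refl) ⟩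
    length (allFin N)                                           ≡⟨ length-allFin N ⟩
    N                                                           ∎)
    where open ≤-Reasoning

  -- a rich vertex forces the left side all rich and the right side all poor,
  -- contradicting the double count of red edges
  rich-impossible : ∀ c → Balanced c → ∀ {i} → Rich c i → ⊥
  rich-impossible c bal {i} rich-i =
    degree-mismatch c red m 1≤N all-rich all-poor
    where
      poor-j : ∃ λ j → j ∈ allFin N × not (rich? (transpose c) j) ≡ true
      poor-j = count-witness _ (allFin N) (≤-trans 1≤m (rich⇒many-poor c bal rich-i))
      all-rich : ∀ i′ → Rich c i′
      all-rich i′ with m ≤? degˡ c red i′
      ... | yes r = r
      ... | no ¬r = ⊥-elim (homogeneous c bal rich-i ¬r)
      all-poor : ∀ j → degʳ c red j < m
      all-poor j with m ≤? degʳ c red j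
      ... | no ¬r = ≰⇒> ¬r
      ... | yes r = ⊥-elim (homogeneous (transpose c) (balanced-transpose bal) r
                              (poor?-sound (transpose c) _ (proj₂ (proj₂ poor-j))))

  balanced-impossible : ∀ c → Balanced c → ⊥
  balanced-impossible c bal with m ≤? degˡ c red (fromℕ< 1≤N)
  ... | yes rich = rich-impossible c bal rich
  ... | no poor
    with j , _ , rich-j ← count-witness _ (allFin N) (≤-trans 1≤n (poor⇒many-rich c bal poor))
    = rich-impossible (transpose c) (balanced-transpose bal) (rich?-sound (transpose c) j rich-j)

  good-edge : ∀ c → GoodEdge c red m ⊎ GoodEdge c blue n
  good-edge c with good-edge? c red m | good-edge? c blue n
  ... | yes r | _     = inj₁ r
  ... | no _  | yes b = inj₂ b
  ... | no ¬r | no ¬b = ⊥-elim (balanced-impossible c (¬r , ¬b))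

-- A col-copy of T maps the neighbours of a vertex z injectively to
-- col-neighbours of its image, so some vertex of K_{N,N} has col-degree ≥ deg z.
-- For N ≤ (m - 1) + (n - 1) the circulant colouring, red exactly when
-- (i + j) mod N < m - 1, has all red degrees < m and all blue degrees < n.

copy-transpose : ∀ {N} {c : Colouring N} {col T} → HasCopy c col T → HasCopy (transpose c) col T
copy-transpose {c = c} {col} (f , f-inj , f-edge) =
  swap ∘ f , (λ eq → f-inj (swap-injective eq)) , (λ w w′ e → swap-edge (f w) (f w′) (f-edge w w′ e))
  where
    swap-injective : ∀ {x y : KVertex _} → swap x ≡ swap y → x ≡ y
    swap-injective {x} {y} eq = trans (sym (swap-involutive x)) (trans (cong swap eq) (swap-involutive y))
    swap-edge : ∀ x y → ColouredEdge c col x y → ColouredEdge (transpose c) col (swap x) (swap y)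
    swap-edge (inj₁ _) (inj₂ _) e = e
    swap-edge (inj₂ _) (inj₁ _) e = e

neighbours : ∀ G → Vertex G → List (Vertex G)
neighbours G z = filterᵇ (adj G z) (allFin (order G))

-- if z is placed at the left vertex i, its neighbours occupy distinct col-neighbours of i
copy-degreeˡ : ∀ {N} {c : Colouring N} {col T} ((f , _) : HasCopy c col T) →
               ∀ z {i} → f z ≡ inj₁ i → degree T z ≤ degˡ c col i
copy-degreeˡ {N} {c} {col} {T} (f , f-inj , f-edge) z {i} fz≡ = begin
  degree T z                               ≡⟨ length-filterᵇ (adj T z) (allFin (order T)) ⟨
  length (neighbours T z)                  ≡⟨ length-map (reduce ∘ f) (neighbours T z) ⟨
  length (map (reduce ∘ f) (neighbours T z)) ≤⟨ pigeonhole (map-unique (reduce ∘ f) (unique-filterᵇ (adj T z) _ (allFin⁺ _)) inj) into ⟩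
  length (filterᵇ (λ j → c i j ==ᶜ col) (allFin N)) ≡⟨ length-filterᵇ _ (allFin N) ⟩
  degˡ c col i                             ∎
  where
    open ≤-Reasoning
    opposite : ∀ {w} → w ∈ neighbours T z → ∃ λ j → f w ≡ inj₂ j × c i j ≡ col
    opposite {w} w∈ with f w | subst (λ x → ColouredEdge c col x (f w)) fz≡
                                     (f-edge z w (proj₂ (∈-filterᵇ⁻ (adj T z) (allFin (order T)) w∈)))
    ... | inj₂ j | e = j , refl , e
    inj : InjectiveOn (reduce ∘ f) (neighbours T z)
    inj w∈ w′∈ eq with opposite w∈ | opposite w′∈
    ... | j , fw≡ , _ | j′ , fw′≡ , _ =
      f-inj (trans fw≡ (trans (cong inj₂ (trans (sym (cong reduce fw≡)) (trans eq (cong reduce fw′≡)))) (sym fw′≡)))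
    into : ∀ {j} → j ∈ map (reduce ∘ f) (neighbours T z) → j ∈ filterᵇ (λ j → c i j ==ᶜ col) (allFin N)
    into j∈ with w , w∈ , refl ← ∈-map⁻ (reduce ∘ f) j∈ with opposite w∈
    ... | j , fw≡ , cij rewrite fw≡ = ∈-filterᵇ⁺ _ (∈-allFin j) (==ᶜ-complete cij)

sparse⇒no-copy : ∀ {N} (c : Colouring N) col {k T} z → degree T z ≡ k →
                 (∀ i → degˡ c col i < k) → (∀ j → degʳ c col j < k) → ¬ HasCopy c col T
sparse⇒no-copy c col {T = T} z deg≡ sparseˡ sparseʳ copy@(f , _) with f z in fz≡
... | inj₁ i = <-irrefl deg≡ (≤-<-trans (copy-degreeˡ {T = T} copy z fz≡) (sparseˡ i))
... | inj₂ j = <-irrefl deg≡ (≤-<-trans (copy-degreeˡ {T = T} (copy-transpose {c = c} {col} {T} copy) z (cong swap fz≡)) (sparseʳ j))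

-- s reduced modulo N, for s < 2N
wrap : ℕ → ℕ → ℕ
wrap N s with s <? N
... | yes _ = s
... | no _  = s ∸ N

wrap-cases : ∀ N s → (s < N × wrap N s ≡ s) ⊎ (N ≤ s × wrap N s + N ≡ s)
wrap-cases N s with s <? N
... | yes s<N = inj₁ (s<N , refl)
... | no s≮N  = inj₂ (≮⇒≥ s≮N , m∸n+n≡m (≮⇒≥ s≮N))

wrap-< : ∀ {N} a x → a < N → x < N → wrap N (a + x) < N
wrap-< {N} a x a<N x<N with wrap-cases N (a + x)
... | inj₁ (a+x<N , w≡) = subst (_< N) (sym w≡) a+x<N
... | inj₂ (_ , w+N≡)   = +-cancelʳ-< N _ N (subst (_< N + N) (sym w+N≡) (+-mono-< a<N x<N))

wrap-injective : ∀ {N} a {x y} → x < N → y < N → wrap N (a + x) ≡ wrap N (a + y) → x ≡ y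
wrap-injective {N} a {x} {y} x<N y<N eq with wrap-cases N (a + x) | wrap-cases N (a + y)
... | inj₁ (_ , ex) | inj₁ (_ , ey) = +-cancelˡ-≡ a x y (trans (sym ex) (trans eq ey))
... | inj₂ (_ , ex) | inj₂ (_ , ey) = +-cancelˡ-≡ a x y (trans (sym ex) (trans (cong (_+ N) eq) ey))
... | inj₁ (_ , ex) | inj₂ (_ , ey) = ⊥-elim (<⇒≱ y<N (subst (N ≤_) (sym y≡x+N) (m≤n+m N x)))
  where y≡x+N : y ≡ x + N
        y≡x+N = +-cancelˡ-≡ a y (x + N) (trans (sym ey) (trans (cong (_+ N) (trans (sym eq) ex)) (+-assoc a x N)))
... | inj₂ (_ , ex) | inj₁ (_ , ey) = ⊥-elim (<⇒≱ x<N (subst (N ≤_) (sym x≡y+N) (m≤n+m N y)))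
  where x≡y+N : x ≡ y + N
        x≡y+N = +-cancelˡ-≡ a x (y + N) (trans (sym ex) (trans (cong (_+ N) (trans eq ey)) (+-assoc a y N)))

module Circulant (N r s : ℕ) (N≤r+s : N ≤ r + s) where

  sumMod : Fin N → Fin N → ℕ
  sumMod i j = wrap N (toℕ i + toℕ j)

  sumMod-< : ∀ i j → sumMod i j < N
  sumMod-< i j = wrap-< (toℕ i) (toℕ j) (toℕ<n i) (toℕ<n j)

  sumMod-injectiveʳ : ∀ i {j j′} → sumMod i j ≡ sumMod i j′ → j ≡ j′
  sumMod-injectiveʳ i eq = toℕ-injective (wrap-injective (toℕ i) (toℕ<n _) (toℕ<n _) eq)

  sumMod-injectiveˡ : ∀ j {i i′} → sumMod i j ≡ sumMod i′ j → i ≡ i′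
  sumMod-injectiveˡ j {i} {i′} eq = sumMod-injectiveʳ j (trans (cong (wrap N) (+-comm (toℕ j) (toℕ i)))
                                     (trans eq (cong (wrap N) (+-comm (toℕ i′) (toℕ j)))))

  colourAt : ℕ → Colour
  colourAt k with k <? r
  ... | yes _ = red
  ... | no _  = blue

  red⇒< : ∀ k → colourAt k ≡ red → k < r
  red⇒< k eq with k <? r
  ... | yes k<r = k<r

  blue⇒≥ : ∀ k → colourAt k ≡ blue → r ≤ k
  blue⇒≥ k eq with k <? r
  ... | no k≮r = ≮⇒≥ k≮r

  colouring : Colouring N
  colouring i j = colourAt (sumMod i j)

  red-count : (κ : Fin N → ℕ) → (∀ {x y} → κ x ≡ κ y → x ≡ y) →
              count (λ x → colourAt (κ x) ==ᶜ red) (allFin N) ≤ r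
  red-count κ κ-inj = count-bound _ (allFin N) (allFin⁺ N) κ (λ _ _ → κ-inj)
                        (λ _ is-red → red⇒< _ (==ᶜ-sound _ _ is-red))

  blue-count : (κ : Fin N → ℕ) → (∀ {x y} → κ x ≡ κ y → x ≡ y) → (∀ x → κ x < N) →
               count (λ x → colourAt (κ x) ==ᶜ blue) (allFin N) ≤ s
  blue-count κ κ-inj κ<N = count-bound _ (allFin N) (allFin⁺ N) (λ x → κ x ∸ r) shifted-inj below
    where
      r≤κ : ∀ {x} → x ∈ filterᵇ (λ x → colourAt (κ x) ==ᶜ blue) (allFin N) → r ≤ κ x
      r≤κ x∈ = blue⇒≥ _ (==ᶜ-sound _ _ (proj₂ (∈-filterᵇ⁻ _ (allFin N) x∈)))
      shifted-inj : InjectiveOn (λ x → κ x ∸ r) (filterᵇ (λ x → colourAt (κ x) ==ᶜ blue) (allFin N))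
      shifted-inj x∈ y∈ eq = κ-inj (trans (sym (m∸n+n≡m (r≤κ x∈))) (trans (cong (_+ r) eq) (m∸n+n≡m (r≤κ y∈))))
      below : ∀ {x} → x ∈ allFin N → colourAt (κ x) ==ᶜ blue ≡ true → κ x ∸ r < s
      below {x} _ is-blue = subst (κ x ∸ r <_) (m+n∸m≡n r s)
                           (∸-monoˡ-< (≤-trans (κ<N x) N≤r+s) (blue⇒≥ _ (==ᶜ-sound _ _ is-blue)))

  red-sparseˡ : ∀ i → degˡ colouring red i < suc r
  red-sparseˡ i = s≤s (red-count (sumMod i) (sumMod-injectiveʳ i))

  red-sparseʳ : ∀ j → degʳ colouring red j < suc r
  red-sparseʳ j = s≤s (red-count (λ i → sumMod i j) (sumMod-injectiveˡ j))

  blue-sparseˡ : ∀ i → degˡ colouring blue i < suc s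
  blue-sparseˡ i = s≤s (blue-count (sumMod i) (sumMod-injectiveʳ i) (sumMod-< i))

  blue-sparseʳ : ∀ j → degʳ colouring blue j < suc s
  blue-sparseʳ j = s≤s (blue-count (λ i → sumMod i j) (sumMod-injectiveˡ j) (λ i → sumMod-< i j))

-- below m + n - 1 the circulant colouring for r = m - 1, s = n - 1 has neither copy
lower-bound : ∀ {m n} (Tm Tn : Graph) → MaxDegree Tm m → 1 ≤ m → MaxDegree Tn n → 1 ≤ n →
              ∀ N → N < m + n ∸ 1 → ¬ Arrows N Tm Tn
lower-bound {suc r} {suc s} Tm Tn (_ , zm , deg-zm) (s≤s z≤n) (_ , zn , deg-zn) (s≤s z≤n) N N< arrows =
  [ sparse⇒no-copy colouring red {T = Tm} zm deg-zm red-sparseˡ  red-sparseʳ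
  , sparse⇒no-copy colouring blue {T = Tn} zn deg-zn blue-sparseˡ blue-sparseʳ ]′ (arrows colouring)
  where open Circulant N r s (≤-pred (subst (suc N ≤_) (+-suc r s) N<))

upper-bound : ∀ {m n} (Tm Tn : Graph) →
              IsTree Tm → DiameterAtMost Tm 3 → MaxDegree Tm m → 1 ≤ m →
              IsTree Tn → DiameterAtMost Tn 3 → MaxDegree Tn n → 1 ≤ n →
              Arrows (m + n ∸ 1) Tm Tn
upper-bound {suc r} {n} Tm Tn tm dm maxm 1≤m tn dn maxn 1≤n c
  with UpperBound.good-edge (suc r) n 1≤m 1≤n refl c
... | inj₁ (i , j , e , di , dj) = inj₁ (double-star-copy Tm tm dm maxm 1≤m c red  i j e di dj)
... | inj₂ (i , j , e , di , dj) = inj₂ (double-star-copy Tn tn dn maxn 1≤n c blue i j e di dj)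

corollary13 : (m n : ℕ) (Tm Tn : Graph) →
    IsTree Tm → DiameterAtMost Tm 3 → MaxDegree Tm m → 1 ≤ m →
    IsTree Tn → DiameterAtMost Tn 3 → MaxDegree Tn n → 1 ≤ n →
    IsBR Tm Tn (m + n ∸ 1)
corollary13 m n Tm Tn tm dm maxm 1≤m tn dn maxn 1≤n =
  upper-bound Tm Tn tm dm maxm 1≤m tn dn maxn 1≤n ,
  lower-bound Tm Tn maxm 1≤m maxn 1≤n
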